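{- Let $\alpha<\beta<\gamma$ be distinct primes, let $G=\langle a\rangle$ be a cyclic group of order $\alpha^2\beta^2\gamma^2$, and let $C=\{x\in G : |x|\in\{\alpha^2,\beta^2,\gamma^2\}\}$. Let $Cay_{p^2}(G,C)$ be the simple undirected graph with vertex set $G$ in which two distinct vertices $x,y$ are adjacent if and only if $xy^{ -1}\in C$. Identify $G$ with $\mathbb{Z}_{\alpha^2}\times\mathbb{Z}_{\beta^2}\times\mathbb{Z}_{\gamma^2}$ via $a^k\mapsto (k \bmod \alpha^2,\ k\bmod \beta^2,\ k\bmod\gamma^2)$. For $(i,j,k)\in\mathbb{Z}_\alpha\times\mathbb{Z}_\beta\times\mathbb{Z}_\gamma$ (represented by integers $0\le i<\alpha$, $0\le j<\beta$, $0\le k<\gamma$), let $C(i,j,k)=\{(i+\alpha x,\ j+\beta y,\ k+\gamma z): x\in\mathbb{Z}_\alpha, y\in\mathbb{Z}_\beta, z\in\mathbb{Z}_\gamma\}$. Let $(i,j,k)\neq(i',j',k')$ be distinct elements of $\mathbb{Z}_\alpha\times\mathbb{Z}_\beta\times\mathbb{Z}_\gamma$. Then no vertex of $C(i,j,k)$ is adjacent to any vertex of $C(i',j',k')$ if and only if the triples $(i,j,k)$ and $(i',j',k')$ do not agree in two of their coordinates.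
   Context: $|x|$ denotes the order of the element $x$ in $G$. -}

module Defs where

open import Data.Nat using (ℕ; _+_; _*_; _^_; _≤_; _<_)
open import Data.Nat.Divisibility using (_∣_)
open import Data.Product using (_×_; ∃; ∃-syntax; Σ-syntax)
open import Data.Sum using (_⊎_)
open import Relation.Binary.PropositionalEquality using (_≡_; _≢_)

-- The cyclic group G = ⟨a⟩ of order N is represented by exponents:
-- the element a^k is represented by the natural number k with k < N.

ord : ℕ → ℕ → ℕ → ℕ
ord α β γ = α ^ 2 * β ^ 2 * γ ^ 2

-- IsOrderOf N k m : the order |a^k| of a^k in a cyclic group of order N is m,
-- i.e. m is the least positive integer with (a^k)^m = e, i.e. N ∣ m * k.
IsOrderOf : ℕ → ℕ → ℕ → Set
IsOrderOf N k m = (0 < m) × (N ∣ m * k) × (∀ m′ → 0 < m′ → N ∣ m′ * k → m ≤ m′)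

InC : ℕ → ℕ → ℕ → ℕ → Set
InC α β γ d =
  IsOrderOf (ord α β γ) d (α ^ 2) ⊎ IsOrderOf (ord α β γ) d (β ^ 2) ⊎ IsOrderOf (ord α β γ) d (γ ^ 2)

-- a^x (a^y)⁻¹ = a^d with 0 ≤ d < N, i.e. d = (x - y) mod N
-- (for 0 ≤ x, y < N this means y + d = x or y + d = x + N).
QuotExp : ℕ → ℕ → ℕ → ℕ → Set
QuotExp N x y d = (d < N) × ((y + d ≡ x) ⊎ (y + d ≡ x + N))

Adjacent : ℕ → ℕ → ℕ → ℕ → ℕ → Set
Adjacent α β γ x y = (x ≢ y) × (∃[ d ] (QuotExp (ord α β γ) x y d × InC α β γ d))

-- a^g ∈ C(i,j,k): under a^g ↦ (g mod α², g mod β², g mod γ²) the image is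
-- (i + αx, j + βy, k + γz) for some x < α, y < β, z < γ.
-- ("g mod M = r" with r < M is written as ∃ q. g = q * M + r.)
InBlock : ℕ → ℕ → ℕ → ℕ → ℕ → ℕ → ℕ → Set
InBlock α β γ i j k g =
  ∃[ x ] ∃[ y ] ∃[ z ] ((x < α) × (y < β) × (z < γ) ×
    (∃[ q ] (g ≡ q * α ^ 2 + (i + α * x))) ×
    (∃[ q ] (g ≡ q * β ^ 2 + (j + β * y))) ×
    (∃[ q ] (g ≡ q * γ ^ 2 + (k + γ * z))))

BlocksAdjacent : ℕ → ℕ → ℕ → ℕ → ℕ → ℕ → ℕ → ℕ → ℕ → Set
BlocksAdjacent α β γ i j k i′ j′ k′ =
  ∃[ g ] ∃[ h ] ((g < ord α β γ) × (h < ord α β γ) ×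
    InBlock α β γ i j k g × InBlock α β γ i′ j′ k′ h × Adjacent α β γ g h)

AgreeInTwo : ℕ → ℕ → ℕ → ℕ → ℕ → ℕ → Set
AgreeInTwo i j k i′ j′ k′ =
  ((i ≡ i′) × (j ≡ j′)) ⊎ ((i ≡ i′) × (k ≡ k′)) ⊎ ((j ≡ j′) × (k ≡ k′))

{-# OPTIONS --safe #-}
-- Membership of a^g in C(i,j,k) depends only on the residues of g modulo α, β and γ.
-- Write N = p²M with p one of the primes. An element a^d has order p² exactly when
-- M ∣ d and p ∤ d, so adjacent vertices joined by an element of order p² have the
-- same residues modulo the two other primes. Conversely, if the two triples agree
-- away from p, the Chinese remainder theorem gives a vertex g of C(i,j,k) and a vertex
-- h of C(i′,j′,k′) with h ≡ g (mod M); their quotient is a multiple of M that p does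
-- not divide, hence has order p².
module Submission where

open import Data.Nat
open import Data.Nat.Properties
open import Data.Nat.DivMod
open import Data.Nat.Divisibility
open import Data.Nat.Coprimality using (Coprime; coprime-divisor; coprime-Bézout; prime⇒coprime)
import Data.Nat.Coprimality as Coprime
open import Data.Nat.GCD using (module Bézout)
open import Data.Nat.Primality using (Prime; prime⇒nonZero; prime⇒irreducible)
open import Data.Nat.Tactic.RingSolver using (solve-∀)
open import Data.Product using (∃-syntax; _×_; _,_; swap; map₂)
open import Data.Sum using (inj₁; inj₂)
open import Function.Bundles using (_⇔_; mk⇔)
open import Relation.Nullary using (¬_; contradiction; contraposition; yes; no)
open import Relation.Binary.PropositionalEquality
open ≡-Reasoning

open import Defs

private
  variable
    a b c d g i k m n p x y M N P : ℕ

∣⇒%-cong : .{{_ : NonZero k}} .{{_ : NonZero m}} → k ∣ m → x % m ≡ y % m → x % k ≡ y % k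
∣⇒%-cong {k} {m} {x} {y} k∣m x≡y = begin
  x % k      ≡⟨ m∣n⇒o%n%m≡o%m k m x k∣m ⟨
  x % m % k  ≡⟨ cong (_% k) x≡y ⟩
  y % m % k  ≡⟨ m∣n⇒o%n%m≡o%m k m y k∣m ⟩
  y % k      ∎

∣⇒%≡ : .{{_ : NonZero k}} .{{_ : NonZero m}} → k ∣ m → x % m ≡ a % m → a < k → x % k ≡ a
∣⇒%≡ k∣m x≡a[m] a<k = trans (∣⇒%-cong k∣m x≡a[m]) (m<n⇒m%n≡m a<k)

m∣m^2 : ∀ m → m ∣ m ^ 2
m∣m^2 m = m∣m*n (m * 1)

m∣m^2*n : ∀ m n → m ∣ m ^ 2 * n
m∣m^2*n m n = ∣m⇒∣m*n n (m∣m^2 m)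

m∣n*m^2 : ∀ m n → m ∣ n * m ^ 2
m∣n*m^2 m n = ∣n⇒∣m*n n (m∣m^2 m)

∣-shift⇒%-cong : .{{_ : NonZero k}} → y + d ≡ x + n → k ∣ n → k ∣ d → y % k ≡ x % k
∣-shift⇒%-cong {k} {y} {d} {x} {n} eq k∣n k∣d = begin
  y % k        ≡⟨ %-remove-+ʳ y k∣d ⟨
  (y + d) % k  ≡⟨ cong (_% k) eq ⟩
  (x + n) % k  ≡⟨ %-remove-+ʳ x k∣n ⟩
  x % k        ∎

%-cong⇒∣-shift : .{{_ : NonZero k}} → y + d ≡ x + n → k ∣ n → y % k ≡ x % k → k ∣ d
%-cong⇒∣-shift {k} {y} {d} {x} {n} eq k∣n y≡x =
  ∣m+n∣m⇒∣n (subst (k ∣_) (sym quotients) (∣m∣n⇒∣m+n (n∣m*n (x / k)) k∣n)) (n∣m*n (y / k))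
  where
  quotients : y / k * k + d ≡ x / k * k + n
  quotients = +-cancelˡ-≡ (y % k) _ _ (begin
    y % k + (y / k * k + d)  ≡⟨ +-assoc (y % k) _ d ⟨
    y % k + y / k * k + d    ≡⟨ cong (_+ d) (m≡m%n+[m/n]*n y k) ⟨
    y + d                    ≡⟨ eq ⟩
    x + n                    ≡⟨ cong (_+ n) (m≡m%n+[m/n]*n x k) ⟩
    x % k + x / k * k + n    ≡⟨ cong (λ r → r + x / k * k + n) y≡x ⟨
    y % k + x / k * k + n    ≡⟨ +-assoc (y % k) _ n ⟩
    y % k + (x / k * k + n)  ∎)

coprime-*ˡ : Coprime a c → Coprime b c → Coprime (a * b) c
coprime-*ˡ {a} {c} a⊥c b⊥c {i} (i∣ab , i∣c) = b⊥c (coprime-divisor i⊥a i∣ab , i∣c)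
  where
  i⊥a : Coprime i a
  i⊥a (j∣i , j∣a) = a⊥c (j∣a , ∣-trans j∣i i∣c)

coprime-*ʳ : Coprime a b → Coprime a c → Coprime a (b * c)
coprime-*ʳ a⊥b a⊥c = Coprime.sym (coprime-*ˡ (Coprime.sym a⊥b) (Coprime.sym a⊥c))

coprime-^ˡ : ∀ n → Coprime a c → Coprime (a ^ n) c
coprime-^ˡ zero    a⊥c (i∣1 , _) = ∣1⇒≡1 i∣1
coprime-^ˡ (suc n) a⊥c = coprime-*ˡ a⊥c (coprime-^ˡ n a⊥c)

coprime-^ : ∀ m n → Coprime a b → Coprime (a ^ m) (b ^ n)
coprime-^ m n a⊥b = coprime-^ˡ m (Coprime.sym (coprime-^ˡ n (Coprime.sym a⊥b)))

<⇒coprime : Prime a → Prime b → a < b → Coprime a b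
<⇒coprime pa pb a<b = Coprime.sym (prime⇒coprime pb {{prime⇒nonZero pa}} a<b)

∤⇒coprime : Prime a → ¬ a ∣ b → Coprime a b
∤⇒coprime pa a∤b (i∣a , i∣b) with prime⇒irreducible pa i∣a
... | inj₁ i≡1 = i≡1
... | inj₂ refl = contradiction i∣b a∤b

bézout⇒crt : .{{_ : NonZero m}} .{{_ : NonZero n}} → 1 + y * n ≡ x * m →
             ∀ a b → ∃[ z ] (z % m ≡ a % m × z % n ≡ b % n)
bézout⇒crt {m} {n} {y} {x} 1+yn≡xm a b = z , z≡a , z≡b
  where
  -- x m is 0 mod m and 1 mod n, while u = y n is -1 mod m, so u² is 1 mod m and 0 mod n.
  u = y * n
  z = b * (x * m) + a * (u * u)

  u²≡1 : u * u + 2 * (x * m) ≡ 1 + (x * m) * (x * m)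
  u²≡1 = begin
    u * u + 2 * (x * m)    ≡⟨ cong (λ v → u * u + 2 * v) 1+yn≡xm ⟨
    u * u + 2 * (1 + u)    ≡⟨ lemma u ⟩
    1 + (1 + u) * (1 + u)  ≡⟨ cong (λ v → 1 + v * v) 1+yn≡xm ⟩
    1 + (x * m) * (x * m)  ∎
    where
    lemma : ∀ u → u * u + 2 * (1 + u) ≡ 1 + (1 + u) * (1 + u)
    lemma = solve-∀

  z≡a : z % m ≡ a % m
  z≡a = begin
    z % m                                  ≡⟨ [m+kn]%n≡m%n z (2 * a * x) m ⟨
    (z + 2 * a * x * m) % m                ≡⟨ cong (_% m) (begin
      z + 2 * a * x * m                          ≡⟨ expand b x m a u ⟩
      b * (x * m) + a * (u * u + 2 * (x * m))    ≡⟨ cong (λ v → b * (x * m) + a * v) u²≡1 ⟩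
      b * (x * m) + a * (1 + (x * m) * (x * m))  ≡⟨ collect b x m a ⟩
      a + (b * x + a * x * x * m) * m            ∎) ⟩
    (a + (b * x + a * x * x * m) * m) % m  ≡⟨ [m+kn]%n≡m%n a (b * x + a * x * x * m) m ⟩
    a % m                                  ∎
    where
    expand : ∀ b x m a u → b * (x * m) + a * (u * u) + 2 * a * x * m ≡ b * (x * m) + a * (u * u + 2 * (x * m))
    expand = solve-∀
    collect : ∀ b x m a → b * (x * m) + a * (1 + (x * m) * (x * m)) ≡ a + (b * x + a * x * x * m) * m
    collect = solve-∀

  z≡b : z % n ≡ b % n
  z≡b = begin
    z % n                                  ≡⟨ cong (λ v → (b * v + a * (u * u)) % n) 1+yn≡xm ⟨
    (b * (1 + u) + a * (u * u)) % n        ≡⟨ cong (_% n) (collect b y n a) ⟩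
    (b + (b * y + a * y * y * n) * n) % n  ≡⟨ [m+kn]%n≡m%n b (b * y + a * y * y * n) n ⟩
    b % n                                  ∎
    where
    collect : ∀ b y n a → b * (1 + y * n) + a * (y * n * (y * n)) ≡ b + (b * y + a * y * y * n) * n
    collect = solve-∀

crt-unbounded : .{{_ : NonZero m}} .{{_ : NonZero n}} → Coprime m n →
                ∀ a b → ∃[ z ] (z % m ≡ a % m × z % n ≡ b % n)
crt-unbounded m⊥n a b with coprime-Bézout m⊥n
... | Bézout.+- x y eq = bézout⇒crt {y = y} {x = x} eq a b
... | Bézout.-+ x y eq = map₂ swap (bézout⇒crt {y = x} {x = y} eq b a)

crt : .{{_ : NonZero m}} .{{_ : NonZero n}} → Coprime m n →
      ∀ a b → ∃[ z ] (z < m * n × z % m ≡ a % m × z % n ≡ b % n)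
crt {m} {n} m⊥n a b = reduce (crt-unbounded m⊥n a b)
  where
  instance
    mn≢0 : NonZero (m * n)
    mn≢0 = m*n≢0 m n
  reduce : ∃[ z ] (z % m ≡ a % m × z % n ≡ b % n) → ∃[ z ] (z < m * n × z % m ≡ a % m × z % n ≡ b % n)
  reduce (z , z≡a , z≡b) = z % (m * n) , m%n<n z (m * n) ,
    trans (m∣n⇒o%n%m≡o%m m (m * n) z (m∣m*n n)) z≡a ,
    trans (m∣n⇒o%n%m≡o%m n (m * n) z (n∣m*n m)) z≡b

quotExp-exists : x < N → y < N → ∃[ d ] QuotExp N x y d
quotExp-exists {x} {N} {y} x<N y<N with y ≤? x
... | yes y≤x = x ∸ y , ≤-<-trans (m∸n≤m x y) x<N , inj₁ (m+[n∸m]≡n y≤x)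
... | no  y≰x = x + N ∸ y , m<n+o⇒m∸n<o (x + N) y {{>-nonZero (≤-<-trans z≤n y<N)}} (+-monoˡ-< N (≰⇒> y≰x)) ,
                inj₂ (m+[n∸m]≡n (≤-trans (<⇒≤ y<N) (m≤n+m N x)))

quotExp⇒shift : QuotExp N x y d → ∃[ n ] (N ∣ n × y + d ≡ x + n)
quotExp⇒shift {N} {x} (_ , inj₁ y+d≡x)   = 0 , N ∣0 , trans y+d≡x (sym (+-identityʳ x))
quotExp⇒shift     (_ , inj₂ y+d≡x+N) = _ , ∣-refl , y+d≡x+N

quotExp-∣⇒%-cong : .{{_ : NonZero k}} → QuotExp N x y d → k ∣ N → k ∣ d → x % k ≡ y % k
quotExp-∣⇒%-cong q k∣N k∣d =
  let _ , N∣n , shift = quotExp⇒shift q in sym (∣-shift⇒%-cong shift (∣-trans k∣N N∣n) k∣d)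

quotExp-%-cong⇒∣ : .{{_ : NonZero k}} → QuotExp N x y d → k ∣ N → x % k ≡ y % k → k ∣ d
quotExp-%-cong⇒∣ q k∣N x≡y =
  let _ , N∣n , shift = quotExp⇒shift q in %-cong⇒∣-shift shift (∣-trans k∣N N∣n) (sym x≡y)

cofactor⇒isOrderOf : N ≡ P * M → 0 < P → M ∣ d → Coprime P d → IsOrderOf N d P
cofactor⇒isOrderOf {P = P} {M} {d} refl 0<P M∣d P⊥d = 0<P , *-monoʳ-∣ P M∣d , minimal
  where
  minimal : ∀ m → 0 < m → P * M ∣ m * d → P ≤ m
  minimal m 0<m PM∣md =
    ∣⇒≤ {{>-nonZero 0<m}} (coprime-divisor P⊥d (subst (P ∣_) (*-comm m d) (m*n∣⇒m∣ P M PM∣md)))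

isOrderOf⇒cofactor∣ : .{{_ : NonZero P}} → N ≡ P * M → IsOrderOf N d P → M ∣ d
isOrderOf⇒cofactor∣ {P} refl (_ , PM∣Pd , _) = *-cancelˡ-∣ P PM∣Pd

isOrderOf-quotExp : Prime p → .{{_ : NonZero p}} .{{_ : NonZero M}} → N ≡ p ^ 2 * M → QuotExp N x y d →
                    x % M ≡ y % M → x % p ≢ y % p → IsOrderOf N d (p ^ 2)
isOrderOf-quotExp {p} {M} {d = d} pp N≡p²M q x≡y[M] x≢y[p] =
  cofactor⇒isOrderOf N≡p²M (m^n>0 p 2) M∣d (coprime-^ˡ 2 (∤⇒coprime pp p∤d))
  where
  M∣d : M ∣ d
  M∣d = quotExp-%-cong⇒∣ q (subst (M ∣_) (sym N≡p²M) (n∣m*n (p ^ 2))) x≡y[M]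
  p∤d : ¬ p ∣ d
  p∤d p∣d = x≢y[p] (quotExp-∣⇒%-cong q (subst (p ∣_) (sym N≡p²M) (m∣m^2*n p M)) p∣d)

isOrderOf⇒%-agree : .{{_ : NonZero P}} .{{_ : NonZero k}} → N ≡ P * M → k ∣ M →
                    QuotExp N x y d → IsOrderOf N d P → x % k ≡ a → y % k ≡ b → a ≡ b
isOrderOf⇒%-agree {P} {k} {N} {d = d} N≡PM k∣M q order x≡a y≡b =
  trans (sym x≡a) (trans (quotExp-∣⇒%-cong q k∣N k∣d) y≡b)
  where
  k∣N : k ∣ N
  k∣N = subst (k ∣_) (sym N≡PM) (∣n⇒∣m*n P k∣M)
  k∣d : k ∣ d
  k∣d = ∣-trans k∣M (isOrderOf⇒cofactor∣ N≡PM order)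

neighbour-of-order-p² : Prime p → .{{_ : NonZero p}} .{{_ : NonZero M}} → N ≡ p ^ 2 * M → Coprime (p ^ 2) M →
            x < N → a < p → x % p ≢ a →
            ∃[ y ] (y < N × y % p ≡ a × y % M ≡ x % M ×
                    x ≢ y × ∃[ d ] (QuotExp N x y d × IsOrderOf N d (p ^ 2)))
neighbour-of-order-p² {p} {M} {N} {x} {a} pp N≡p²M p²⊥M x<N a<p x≢a[p]
  with crt {{m^n≢0 p 2}} p²⊥M a x
... | y , y<p²M , y≡a[p²] , y≡x[M] =
  let d , q = quotExp-exists x<N y<N in
  y , y<N , y≡a , y≡x[M] , x≢y , d , q , isOrderOf-quotExp pp N≡p²M q (sym y≡x[M]) x≢y[p]
  where
  y<N : y < N
  y<N = subst (y <_) (sym N≡p²M) y<p²M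
  y≡a : y % p ≡ a
  y≡a = ∣⇒%≡ {{_}} {{m^n≢0 p 2}} (m∣m^2 p) y≡a[p²] a<p
  x≢y[p] : x % p ≢ y % p
  x≢y[p] x≡y = x≢a[p] (trans x≡y y≡a)
  x≢y : x ≢ y
  x≢y refl = x≢y[p] refl

blockCoordinate⇒% : .{{_ : NonZero p}} → i < p → ∃[ q ] (g ≡ q * p ^ 2 + (i + p * x)) → g % p ≡ i
blockCoordinate⇒% {p} {i} {x = x} i<p (q , refl) = begin
  (q * p ^ 2 + (i + p * x)) % p  ≡⟨ %-remove-+ˡ (i + p * x) (m∣n*m^2 p q) ⟩
  (i + p * x) % p                ≡⟨ %-remove-+ʳ i (m∣m*n x) ⟩
  i % p                          ≡⟨ m<n⇒m%n≡m i<p ⟩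
  i                              ∎

%⇒blockCoordinate : ∀ p g .{{_ : NonZero p}} → ∃[ x ] (x < p × ∃[ q ] (g ≡ q * p ^ 2 + (g % p + p * x)))
%⇒blockCoordinate p g = g / p % p , m%n<n (g / p) p , g / p / p , (begin
  g                                             ≡⟨ m≡m%n+[m/n]*n g p ⟩
  g % p + g / p * p                             ≡⟨ cong (λ t → g % p + t * p) (m≡m%n+[m/n]*n (g / p) p) ⟩
  g % p + (g / p % p + g / p / p * p) * p       ≡⟨ rearrange (g % p) (g / p % p) (g / p / p) p ⟩
  g / p / p * p ^ 2 + (g % p + p * (g / p % p)) ∎)
  where
  rearrange : ∀ r x q p → r + (x + q * p) * p ≡ q * (p * (p * 1)) + (r + p * x)
  rearrange = solve-∀

module _ {α β γ : ℕ} .{{_ : NonZero α}} .{{_ : NonZero β}} .{{_ : NonZero γ}} where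

  inBlock⇒% : ∀ {i j k g} → i < α → j < β → k < γ → InBlock α β γ i j k g →
              g % α ≡ i × g % β ≡ j × g % γ ≡ k
  inBlock⇒% i<α j<β k<γ (_ , _ , _ , _ , _ , _ , gα , gβ , gγ) =
    blockCoordinate⇒% i<α gα , blockCoordinate⇒% j<β gβ , blockCoordinate⇒% k<γ gγ

  %⇒inBlock : ∀ {i j k g} → g % α ≡ i → g % β ≡ j → g % γ ≡ k → InBlock α β γ i j k g
  %⇒inBlock {g = g} refl refl refl =
    let x , x<α , gα = %⇒blockCoordinate α g
        y , y<β , gβ = %⇒blockCoordinate β g
        z , z<γ , gγ = %⇒blockCoordinate γ g
    in x , y , z , x<α , y<β , z<γ , gα , gβ , gγ

module _ {α β γ : ℕ} (pα : Prime α) (pβ : Prime β) (pγ : Prime γ) (α<β : α < β) (β<γ : β < γ) where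

  private instance
    α≢0 : NonZero α
    α≢0 = prime⇒nonZero pα
    β≢0 : NonZero β
    β≢0 = prime⇒nonZero pβ
    γ≢0 : NonZero γ
    γ≢0 = prime⇒nonZero pγ
    α²≢0 : NonZero (α ^ 2)
    α²≢0 = m^n≢0 α 2
    β²≢0 : NonZero (β ^ 2)
    β²≢0 = m^n≢0 β 2
    γ²≢0 : NonZero (γ ^ 2)
    γ²≢0 = m^n≢0 γ 2
    α²β²≢0 : NonZero (α ^ 2 * β ^ 2)
    α²β²≢0 = m*n≢0 (α ^ 2) (β ^ 2)
    α²γ²≢0 : NonZero (α ^ 2 * γ ^ 2)
    α²γ²≢0 = m*n≢0 (α ^ 2) (γ ^ 2)
    β²γ²≢0 : NonZero (β ^ 2 * γ ^ 2)
    β²γ²≢0 = m*n≢0 (β ^ 2) (γ ^ 2)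

  private
    α²⊥β² : Coprime (α ^ 2) (β ^ 2)
    α²⊥β² = coprime-^ 2 2 (<⇒coprime pα pβ α<β)
    β²⊥γ² : Coprime (β ^ 2) (γ ^ 2)
    β²⊥γ² = coprime-^ 2 2 (<⇒coprime pβ pγ β<γ)
    α²⊥γ² : Coprime (α ^ 2) (γ ^ 2)
    α²⊥γ² = coprime-^ 2 2 (<⇒coprime pα pγ (<-trans α<β β<γ))

    ord≡α²* : ord α β γ ≡ α ^ 2 * (β ^ 2 * γ ^ 2)
    ord≡α²* = *-assoc (α ^ 2) (β ^ 2) (γ ^ 2)
    ord≡β²* : ord α β γ ≡ β ^ 2 * (α ^ 2 * γ ^ 2)
    ord≡β²* = trans (cong (_* γ ^ 2) (*-comm (α ^ 2) (β ^ 2))) (*-assoc (β ^ 2) (α ^ 2) (γ ^ 2))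
    ord≡γ²* : ord α β γ ≡ γ ^ 2 * (α ^ 2 * β ^ 2)
    ord≡γ²* = *-comm (α ^ 2 * β ^ 2) (γ ^ 2)

  blocksAdjacent⇒agreeInTwo : ∀ {i j k i′ j′ k′} → i < α → j < β → k < γ → i′ < α → j′ < β → k′ < γ →
                              BlocksAdjacent α β γ i j k i′ j′ k′ → AgreeInTwo i j k i′ j′ k′
  blocksAdjacent⇒agreeInTwo i<α j<β k<γ i′<α j′<β k′<γ (_ , _ , _ , _ , g∈ , h∈ , _ , _ , q , order)
    with inBlock⇒% i<α j<β k<γ g∈ | inBlock⇒% i′<α j′<β k′<γ h∈ | order
  ... | gα , gβ , gγ | hα , hβ , hγ | inj₁ o =
    inj₂ (inj₂ ( isOrderOf⇒%-agree ord≡α²* (m∣m^2*n β (γ ^ 2)) q o gβ hβ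
               , isOrderOf⇒%-agree ord≡α²* (m∣n*m^2 γ (β ^ 2)) q o gγ hγ))
  ... | gα , gβ , gγ | hα , hβ , hγ | inj₂ (inj₁ o) =
    inj₂ (inj₁ ( isOrderOf⇒%-agree ord≡β²* (m∣m^2*n α (γ ^ 2)) q o gα hα
               , isOrderOf⇒%-agree ord≡β²* (m∣n*m^2 γ (α ^ 2)) q o gγ hγ))
  ... | gα , gβ , gγ | hα , hβ , hγ | inj₂ (inj₂ o) =
    inj₁ ( isOrderOf⇒%-agree ord≡γ²* (m∣m^2*n α (β ^ 2)) q o gα hα
         , isOrderOf⇒%-agree ord≡γ²* (m∣n*m^2 β (α ^ 2)) q o gβ hβ)

  vertex-with-residues : ∀ {i j k} → i < α → j < β → k < γ →
           ∃[ g ] (g < ord α β γ × g % α ≡ i × g % β ≡ j × g % γ ≡ k)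
  vertex-with-residues {i} {j} {k} i<α j<β k<γ =
    let r , _ , r≡i , r≡j = crt α²⊥β² i j
        g , g<N , g≡r , g≡k = crt (coprime-*ˡ α²⊥γ² β²⊥γ²) r k
    in g , g<N ,
       trans (∣⇒%-cong (m∣m^2*n α (β ^ 2)) g≡r) (∣⇒%≡ (m∣m^2 α) r≡i i<α) ,
       trans (∣⇒%-cong (m∣n*m^2 β (α ^ 2)) g≡r) (∣⇒%≡ (m∣m^2 β) r≡j j<β) ,
       ∣⇒%≡ (m∣m^2 γ) g≡k k<γ

  agreeInTwo⇒blocksAdjacent : ∀ {i j k i′ j′ k′} → i < α → j < β → k < γ → i′ < α → j′ < β → k′ < γ →
                              (i , j , k) ≢ (i′ , j′ , k′) →
                              AgreeInTwo i j k i′ j′ k′ → BlocksAdjacent α β γ i j k i′ j′ k′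
  agreeInTwo⇒blocksAdjacent {i} {j} {k} i<α j<β k<γ _ _ k′<γ distinct (inj₁ (refl , refl)) =
    let g , g<N , gα , gβ , gγ = vertex-with-residues i<α j<β k<γ
        h , h<N , hγ , h≡g , g≢h , d , q , o =
          neighbour-of-order-p² pγ ord≡γ²* (coprime-*ʳ (Coprime.sym α²⊥γ²) (Coprime.sym β²⊥γ²)) g<N k′<γ
                    (λ g≡k′ → distinct (cong (λ z → i , j , z) (trans (sym gγ) g≡k′)))
    in g , h , g<N , h<N , %⇒inBlock gα gβ gγ ,
       %⇒inBlock (trans (∣⇒%-cong (m∣m^2*n α (β ^ 2)) h≡g) gα)
                 (trans (∣⇒%-cong (m∣n*m^2 β (α ^ 2)) h≡g) gβ)
                 hγ ,
       g≢h , d , q , inj₂ (inj₂ o)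
  agreeInTwo⇒blocksAdjacent {i} {j} {k} i<α j<β k<γ _ j′<β _ distinct (inj₂ (inj₁ (refl , refl))) =
    let g , g<N , gα , gβ , gγ = vertex-with-residues i<α j<β k<γ
        h , h<N , hβ , h≡g , g≢h , d , q , o =
          neighbour-of-order-p² pβ ord≡β²* (coprime-*ʳ (Coprime.sym α²⊥β²) β²⊥γ²) g<N j′<β
                    (λ g≡j′ → distinct (cong (λ z → i , z , k) (trans (sym gβ) g≡j′)))
    in g , h , g<N , h<N , %⇒inBlock gα gβ gγ ,
       %⇒inBlock (trans (∣⇒%-cong (m∣m^2*n α (γ ^ 2)) h≡g) gα)
                 hβ
                 (trans (∣⇒%-cong (m∣n*m^2 γ (α ^ 2)) h≡g) gγ) ,
       g≢h , d , q , inj₂ (inj₁ o)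
  agreeInTwo⇒blocksAdjacent {i} {j} {k} i<α j<β k<γ i′<α _ _ distinct (inj₂ (inj₂ (refl , refl))) =
    let g , g<N , gα , gβ , gγ = vertex-with-residues i<α j<β k<γ
        h , h<N , hα , h≡g , g≢h , d , q , o =
          neighbour-of-order-p² pα ord≡α²* (coprime-*ʳ α²⊥β² α²⊥γ²) g<N i′<α
                    (λ g≡i′ → distinct (cong (λ z → z , j , k) (trans (sym gα) g≡i′)))
    in g , h , g<N , h<N , %⇒inBlock gα gβ gγ ,
       %⇒inBlock hα
                 (trans (∣⇒%-cong (m∣m^2*n β (γ ^ 2)) h≡g) gβ)
                 (trans (∣⇒%-cong (m∣n*m^2 γ (β ^ 2)) h≡g) gγ) ,
       g≢h , d , q , inj₁ o

proposition2p11 : (α β γ : ℕ) → Prime α → Prime β → Prime γ → α < β → β < γ →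
    (i j k i′ j′ k′ : ℕ) → i < α → j < β → k < γ → i′ < α → j′ < β → k′ < γ →
    (i , j , k) ≢ (i′ , j′ , k′) →
    (¬ BlocksAdjacent α β γ i j k i′ j′ k′) ⇔ (¬ AgreeInTwo i j k i′ j′ k′)
proposition2p11 α β γ pα pβ pγ α<β β<γ i j k i′ j′ k′ i<α j<β k<γ i′<α j′<β k′<γ distinct =
  mk⇔ (contraposition (agreeInTwo⇒blocksAdjacent pα pβ pγ α<β β<γ i<α j<β k<γ i′<α j′<β k′<γ distinct))
      (contraposition (blocksAdjacent⇒agreeInTwo pα pβ pγ α<β β<γ i<α j<β k<γ i′<α j′<β k′<γ))
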